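{- Let $\lambda$ be a partition, $\pi$ a reverse plane partition of shape $\lambda$, $h\in\mathcal F(\pi)$ a factor of $\pi$, and $P$ a south-west path in $\lambda$ such that $\omega(P)=\omega(h)$, $\ell(P)=\ell(h)$, $(P,\pi)$ is compatible and $\pi-P$ is a reverse plane partition. Let $v=\alpha(P)$. Then $v\in\mathrm{cand}(\pi)$ and $P$ is the reverse path of $Q(v,\pi)$.
   Context: Cells are pairs $(i,j)\in\mathbb Z^2$; $\mathrm n(i,j)=(i-1,j)$, $\mathrm e(i,j)=(i,j+1)$, $\mathrm s(i,j)=(i+1,j)$, $\mathrm w(i,j)=(i,j-1)$. A partition $\lambda$ is identified with its Young diagram. A reverse plane partition of shape $\lambda$ is $\pi:\lambda\to\mathbb N$ with $\pi(u)\le\pi(\mathrm e u),\pi(\mathrm s u)$, with conventions $\pi(i,j)=0$ if $i\le0$ or $j\le0$, $\pi(i,j)=\infty$ if $i,j\ge1$, $(i,j)\notin\lambda$. Content $c(i,j)=j-i$; outer corner: $u\in\lambda$, $\mathrm e u,\mathrm s u\notin\lambda$; inner corner: $\mathrm e u,\mathrm s u\in\lambda$, $\mathrm e\mathrm s u\notin\lambda$. With inner corner contents $i_1<\dots<i_r$ and outer corner contents $o_1<\dots<o_{r+1}$ (interlacing), $\mathcal I=\{u\in\lambda:c(u)=i_k\}$, $\mathcal O=\{u\in\lambda:c(u)=o_k\}$, $\mathcal A=\{u\in\lambda:c(u)<o_1\text{ or }i_k<c(u)<o_{k+1}\text{ for some }k\in[r]\}$, $\mathcal B=\{u\in\lambda:o_k<c(u)<i_k\text{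 for some }k\in[r]\text{ or }c(u)>o_{r+1}\}$. Candidates: $\mathrm{cand}(\pi)=\{u\in\mathcal O:\pi(u)>\pi(\mathrm w u)\}\cup\{u\in\mathcal A:\pi(u)>\pi(\mathrm w u),\pi(u)>\pi(\mathrm n u)\}$. North-east path: $(u_0,\dots,u_s)$ in $\lambda$, $u_k\in\{\mathrm n u_{k-1},\mathrm e u_{k-1}\}$, length $s$, head $\alpha=u_0$, tail $\omega=u_s$. South-west path: $(v_0,\dots,v_s)$, $v_k\in\{\mathrm s v_{k-1},\mathrm w v_{k-1}\}$, length $s$, $\alpha=v_s$, $\omega=v_0$. The reverse of $(u_0,\dots,u_s)$ is $(u_s,\dots,u_0)$. Rim-hook: north-east path $h$ with $\mathrm s\alpha(h)\notin\lambda$, $\mathrm e\omega(h)\notin\lambda$, $\mathrm e\mathrm s u\notin\lambda$ for all $u\in h$. $(\pi-P)(u)=\pi(u)-1$ for $u\in P$, else $\pi(u)$. $(P,\pi)$ compatible: $u\in P\cap(\mathcal I\cup\mathcal A)$ implies $\mathrm e u\in P$ and $\pi(u)=\pi(\mathrm e u)$; $u,\mathrm s u\in P$ implies $\pi(u)=\pi(\mathrm s u)$. A rim-hook $h$ is a factor of $\pi$ ($h\in\mathcal F(\pi)$) if there is a south-west path $P$ with $\omega(P)=\omega(h)$, $\ell(P)=\ell(h)$, $(P,\pi)$ compatible and $\pi-P$ a reverse plane partition. For $v\in\mathrm{cand}(\pi)$, $Q(v,\pi)$ is the north-east path starting at $v$ which, from the current cell $u$, moves to $\mathrm n u$ if $u\in\mathcal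 O\cup\mathcal B$ and $\pi(u)=\pi(\mathrm n u)$; moves to $\mathrm e u$ if $u\in\mathcal I\cup\mathcal A$, or if $\mathrm e u\in\lambda$ and $\pi(u)>\pi(\mathrm n u)$; and terminates if $\pi(u)>\pi(\mathrm n u)$ and $\mathrm e u\notin\lambda$. -}

module Defs where

open import Data.Nat as ℕ using (ℕ; zero; suc; _∸_)
import Data.Nat.Properties as ℕP
open import Data.Integer as ℤ using (ℤ; +_; _-_; 0ℤ; 1ℤ)
import Data.Integer.Properties as ℤP
open import Data.Product using (Σ; _×_; _,_; proj₁; proj₂; ∃)
open import Data.Product.Properties using (≡-dec)
open import Data.Sum using (_⊎_)
open import Data.List as List using (List; []; _∷_; _++_; map; length; filter; upTo)
open import Data.List.NonEmpty as List⁺ using (List⁺; toList)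
open import Data.List.Relation.Unary.All using (All)
open import Data.List.Relation.Unary.Linked using (Linked)
open import Data.List.Membership.Propositional using (_∈_)
import Data.List.Membership.DecPropositional as DecMem
open import Data.List.Sort ℤP.≤-decTotalOrder using (sort)
open import Data.Bool using (if_then_else_)
open import Relation.Nullary using (¬_; Dec; does)
open import Relation.Nullary.Decidable using (_×-dec_; ¬?)
open import Relation.Binary.PropositionalEquality using (_≡_)
open import Relation.Binary.Definitions using (DecidableEquality)

-- Cells of a Young diagram have both coordinates ≥ 1; we use
-- ℕ × ℕ, row 0 / column 0 playing the role of the region i ≤ 0 / j ≤ 0.
-- (n and w are only ever applied to cells of λ, so the truncated
-- subtraction never matters.)

Cell : Set
Cell = ℕ × ℕ

n s e w : Cell → Cell
n (i , j) = (i ∸ 1 , j)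
e (i , j) = (i , suc j)
s (i , j) = (suc i , j)
w (i , j) = (i , j ∸ 1)

_≟ᶜ_ : DecidableEquality Cell
_≟ᶜ_ = ≡-dec ℕP._≟_ ℕP._≟_

c : Cell → ℤ
c (i , j) = + j - + i

record Partition : Set where
  field
    rows       : List ℕ
    decreasing : Linked ℕ._≥_ rows
    positive   : All (ℕ._<_ 0) rows
open Partition public

nthℕ : List ℕ → ℕ → ℕ
nthℕ []       _       = 0
nthℕ (x ∷ xs) zero    = x
nthℕ (x ∷ xs) (suc k) = nthℕ xs k

rowLen : Partition → ℕ → ℕ
rowLen sh zero    = 0
rowLen sh (suc i) = nthℕ (rows sh) i

_∈λ_ : Cell → Partition → Set
(i , j) ∈λ sh = 1 ℕ.≤ i × 1 ℕ.≤ j × j ℕ.≤ rowLen sh i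

_∈λ?_ : (u : Cell) (sh : Partition) → Dec (u ∈λ sh)
(i , j) ∈λ? sh = (1 ℕ.≤? i) ×-dec ((1 ℕ.≤? j) ×-dec (j ℕ.≤? rowLen sh i))

cellsFrom : ℕ → List ℕ → List Cell
cellsFrom i []       = []
cellsFrom i (l ∷ ls) = map (λ j → (i , suc j)) (upTo l) ++ cellsFrom (suc i) ls

cells : Partition → List Cell
cells sh = cellsFrom 1 (rows sh)

OuterCorner : Partition → Cell → Set
OuterCorner sh u = u ∈λ sh × ¬ (e u ∈λ sh) × ¬ (s u ∈λ sh)

InnerCorner : Partition → Cell → Set
InnerCorner sh u = e u ∈λ sh × s u ∈λ sh × ¬ (e (s u) ∈λ sh)

outerCorner? : (sh : Partition) (u : Cell) → Dec (OuterCorner sh u)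
outerCorner? sh u = (u ∈λ? sh) ×-dec (¬? (e u ∈λ? sh) ×-dec ¬? (s u ∈λ? sh))

innerCorner? : (sh : Partition) (u : Cell) → Dec (InnerCorner sh u)
innerCorner? sh u = (e u ∈λ? sh) ×-dec ((s u ∈λ? sh) ×-dec ¬? (e (s u) ∈λ? sh))

-- o₁ < ... < o_{r+1}  and  i₁ < ... < i_r  (increasing lists)
outerContents : Partition → List ℤ
outerContents sh = sort (map c (filter (outerCorner? sh) (cells sh)))

innerContents : Partition → List ℤ
innerContents sh = sort (map c (filter (innerCorner? sh) (cells sh)))

-- 0-based lookup with default (only used at valid indices)
nth : List ℤ → ℕ → ℤ
nth []       _       = 0ℤ
nth (x ∷ xs) zero    = x
nth (x ∷ xs) (suc k) = nth xs k

-- i_k = iC sh (k-1),  o_k = oC sh (k-1)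
iC oC : Partition → ℕ → ℤ
iC sh = nth (innerContents sh)
oC sh = nth (outerContents sh)

r : Partition → ℕ
r sh = length (innerContents sh)

𝓘 : Partition → Cell → Set
𝓘 sh u = u ∈λ sh × c u ∈ innerContents sh

𝓞 : Partition → Cell → Set
𝓞 sh u = u ∈λ sh × c u ∈ outerContents sh

𝓐 : Partition → Cell → Set
𝓐 sh u = u ∈λ sh ×
  (c u ℤ.< oC sh 0
   ⊎ Σ ℕ (λ k → k ℕ.< r sh × iC sh k ℤ.< c u × c u ℤ.< oC sh (suc k)))

𝓑 : Partition → Cell → Set
𝓑 sh u = u ∈λ sh ×
  (Σ ℕ (λ k → k ℕ.< r sh × oC sh k ℤ.< c u × c u ℤ.< iC sh k)
   ⊎ oC sh (r sh) ℤ.< c u)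

-- Fillings.  A filling is a function Cell → ℤ; only its values on λ
-- matter.  `val` implements the convention π(i,j) = 0 if i ≤ 0 or j ≤ 0.

Filling : Set
Filling = Cell → ℤ

val : Filling → Cell → ℤ
val π (zero  , j)     = 0ℤ
val π (suc i , zero)  = 0ℤ
val π (suc i , suc j) = π (suc i , suc j)

-- reverse plane partition of shape λ: values in ℕ, weakly increasing
-- along rows and columns (the convention π = ∞ outside λ means that
-- no condition is imposed when e u or s u lies outside λ)
RPP : Partition → Filling → Set
RPP sh π = ∀ u → u ∈λ sh →
  (0ℤ ℤ.≤ π u)
  × (e u ∈λ sh → π u ℤ.≤ π (e u))
  × (s u ∈λ sh → π u ℤ.≤ π (s u))

Path : Set
Path = List⁺ Cell

_∈P_ : Cell → Path → Set
u ∈P p = u ∈ toList p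

NEStep : Cell → Cell → Set
NEStep u u′ = u′ ≡ n u ⊎ u′ ≡ e u

SWStep : Cell → Cell → Set
SWStep v v′ = v′ ≡ s v ⊎ v′ ≡ w v

NEPath : Partition → Path → Set
NEPath sh p = All (_∈λ sh) (toList p) × Linked NEStep (toList p)

SWPath : Partition → Path → Set
SWPath sh p = All (_∈λ sh) (toList p) × Linked SWStep (toList p)

len : Path → ℕ
len p = length (List⁺.tail p)

αNE ωNE : Path → Cell
αNE = List⁺.head
ωNE = List⁺.last

-- south-west path (v₀,…,v_s): α = v_s, ω = v₀
αSW ωSW : Path → Cell
αSW = List⁺.last
ωSW = List⁺.head

RimHook : Partition → Path → Set
RimHook sh h = NEPath sh h
  × ¬ (s (αNE h) ∈λ sh)
  × ¬ (e (ωNE h) ∈λ sh)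
  × (∀ u → u ∈P h → ¬ (e (s u) ∈λ sh))

_⊖_ : Filling → Path → Filling
(π ⊖ P) u = if does (DecMem._∈?_ _≟ᶜ_ u (toList P)) then π u - 1ℤ else π u

Compatible : Partition → Path → Filling → Set
Compatible sh P π =
  (∀ u → u ∈P P → (𝓘 sh u ⊎ 𝓐 sh u) → e u ∈P P × π u ≡ π (e u))
  × (∀ u → u ∈P P → s u ∈P P → π u ≡ π (s u))

Factor : Partition → Filling → Path → Set
Factor sh π h = RimHook sh h ×
  ∃ λ P → SWPath sh P × ωSW P ≡ ωNE h × len P ≡ len h
        × Compatible sh P π × RPP sh (π ⊖ P)

Cand : Partition → Filling → Cell → Set
Cand sh π u =
  (𝓞 sh u × val π (w u) ℤ.< π u)
  ⊎ (𝓐 sh u × val π (w u) ℤ.< π u × val π (n u) ℤ.< π u)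

QStep : Partition → Filling → Cell → Cell → Set
QStep sh π u u′ =
  ((𝓞 sh u ⊎ 𝓑 sh u) × π u ≡ val π (n u) × u′ ≡ n u)
  ⊎ (((𝓘 sh u ⊎ 𝓐 sh u) ⊎ (e u ∈λ sh × val π (n u) ℤ.< π u)) × u′ ≡ e u)

QStop : Partition → Filling → Cell → Set
QStop sh π u = val π (n u) ℤ.< π u × ¬ (e u ∈λ sh)

IsQ : Partition → Filling → Cell → Path → Set
IsQ sh π v q = NEPath sh q × List⁺.head q ≡ v
  × Linked (QStep sh π) (toList q) × QStop sh π (List⁺.last q)

-- Reversing P gives a north-east path q along which the content grows by one at
-- each step, so P meets every content at most once. With compatibility this makes
-- every step of q the one prescribed by the rule defining Q(v, π): a vertical step
-- of P starts in 𝓞 ∪ 𝓑 (a cell of 𝓘 ∪ 𝓐 would drag into P its east neighbour, which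
-- has the content of its north neighbour) and keeps π constant, while a horizontal
-- step leaves the north neighbour outside P, and π − P being a reverse plane
-- partition forces π to increase strictly into P. The same strictness gives the
-- stopping condition at ω(P) and the candidate inequalities at v = α(P). Finally v
-- has the content of the bottom cell α(h) of the rim hook, and counting corners row
-- by row shows that below such a content there are no more outer than inner corner
-- contents; hence v lies in neither 𝓘 nor 𝓑.

module Submission where

open import Defs
open import Data.Integer using (ℤ)
open import Data.Product using (_×_; ∃)
open import Data.List using (reverse)
open import Data.List.NonEmpty using (toList)
open import Relation.Binary.PropositionalEquality using (_≡_)

open import Level using (0ℓ)
open import Function using (id; flip; _∘_)
open import Data.Empty using (⊥-elim)
open import Data.Unit using (⊤; tt)
open import Data.Nat as ℕ using (ℕ; zero; suc; z≤n; s≤s)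
import Data.Nat.Properties as ℕP
open import Data.Integer as ℤ using (+_; 0ℤ; 1ℤ)
import Data.Integer.Properties as ℤP
open import Data.Integer.Tactic.RingSolver using (solve-∀)
open import Algebra.Properties.AbelianGroup ℤP.+-0-abelianGroup using (∙-cancelʳ)
open import Data.Product using (Σ; _,_; proj₁; proj₂)
open import Data.Sum as Sum using (_⊎_; inj₁; inj₂)
open import Data.List as List using (List; []; _∷_; _++_; map; length; filter; upTo)
import Data.List.Properties as ListP
open import Data.List.NonEmpty as List⁺ using (List⁺; _∷_; _⁺∷ʳ_)
open import Data.List.Relation.Unary.All as All using (All; []; _∷_)
import Data.List.Relation.Unary.All.Properties as AllP
open import Data.List.Relation.Unary.Any using (here; there)
import Data.List.Relation.Unary.Any.Properties as AnyP
open import Data.List.Relation.Unary.Linked as Linked using (Linked; []; [-]; _∷_)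
import Data.List.Relation.Unary.Linked.Properties as LinkedP
open import Data.List.Relation.Unary.Sorted.TotalOrder ℤP.≤-totalOrder using (Sorted)
open import Data.List.Membership.Propositional using (_∈_; _∉_)
open import Data.List.Membership.Propositional.Properties using (∈-map⁻; ∈-filter⁻)
open import Data.List.Relation.Binary.Permutation.Propositional using (_↭_)
open import Data.List.Relation.Binary.Permutation.Propositional.Properties
  using (filter-↭; ↭-length; ∈-resp-↭)
open import Data.List.Sort ℤP.≤-decTotalOrder using (sort-↭; sort-↗)
import Data.List.Membership.DecPropositional as DecMembership
open import Relation.Nullary using (¬_; Dec; yes; no; does)
open import Data.Bool using (if_then_else_)
open import Relation.Unary using (Pred; Decidable; ∁)
open import Relation.Binary.Definitions using (tri<; tri≈; tri>)
open import Relation.Binary.PropositionalEquality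
  using (_≢_; refl; sym; trans; cong; cong₂; subst; subst₂; module ≡-Reasoning)

module _ {A : Set} where

  last⁺-∷ : (x y : A) (ys : List A) → List⁺.last (x ∷ y ∷ ys) ≡ List⁺.last (y ∷ ys)
  last⁺-∷ x y ys with List.initLast ys
  ... | []            = refl
  ... | _ List.∷ʳ′ _ = refl

  last-⁺∷ʳ : (p : List⁺ A) (x : A) → List⁺.last (p ⁺∷ʳ x) ≡ x
  last-⁺∷ʳ (y ∷ ys) = go y ys
    where
    go : (y : A) (ys : List A) (x : A) → List⁺.last ((y ∷ ys) ⁺∷ʳ x) ≡ x
    go y []       x = refl
    go y (z ∷ zs) x = trans (last⁺-∷ y z (zs List.∷ʳ x)) (go z zs x)

  reverseFrom : A → List A → List⁺ A
  reverseFrom x []       = x ∷ []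
  reverseFrom x (y ∷ ys) = reverseFrom y ys ⁺∷ʳ x

  reverse⁺ : List⁺ A → List⁺ A
  reverse⁺ (x ∷ xs) = reverseFrom x xs

  toList-reverse⁺ : (p : List⁺ A) → toList (reverse⁺ p) ≡ reverse (toList p)
  toList-reverse⁺ (x ∷ xs) = go x xs
    where
    go : (x : A) (xs : List A) → toList (reverseFrom x xs) ≡ reverse (x ∷ xs)
    go x []       = refl
    go x (y ∷ ys) = trans (cong (List._∷ʳ x) (go y ys)) (sym (ListP.unfold-reverse x (y ∷ ys)))

  head-reverse⁺ : (p : List⁺ A) → List⁺.head (reverse⁺ p) ≡ List⁺.last p
  head-reverse⁺ (x ∷ xs) = go x xs
    where
    go : (x : A) (xs : List A) → List⁺.head (reverseFrom x xs) ≡ List⁺.last (x ∷ xs)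
    go x []       = refl
    go x (y ∷ ys) = trans (go y ys) (sym (last⁺-∷ x y ys))

  last-reverse⁺ : (p : List⁺ A) → List⁺.last (reverse⁺ p) ≡ List⁺.head p
  last-reverse⁺ (x ∷ [])     = refl
  last-reverse⁺ (x ∷ y ∷ ys) = last-⁺∷ʳ (reverseFrom y ys) x

  reverse-Linked : ∀ {R : A → A → Set} {xs} → Linked R xs → Linked (flip R) (reverse xs)
  reverse-Linked []            = []
  reverse-Linked {xs = _ ∷ _} rs = go [-] rs
    where
    go : ∀ {R : A → A → Set} {x acc xs} → Linked (flip R) (x ∷ acc) → Linked R (x ∷ xs) →
         Linked (flip R) (List.reverseAcc (x ∷ acc) xs)
    go racc [-]        = racc
    go racc (rxy ∷ rs) = go (rxy ∷ racc) rs

  reverse-All : ∀ {Q : A → Set} {xs} → All Q xs → All Q (reverse xs)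
  reverse-All qs = All.tabulate (All.lookup qs ∘ AnyP.reverse⁻)

  Linked-with-All : ∀ {Q : A → Set} {R : A → A → Set} {xs} →
    All Q xs → Linked R xs → Linked (λ a b → (Q a × Q b) × R a b) xs
  Linked-with-All _                []         = []
  Linked-with-All _                [-]        = [-]
  Linked-with-All (qa ∷ qs@(qb ∷ _)) (rab ∷ rs) = ((qa , qb) , rab) ∷ Linked-with-All qs rs

  count : {P : Pred A 0ℓ} → Decidable P → List A → ℕ
  count P? xs = length (filter P? xs)

  module _ {P : Pred A 0ℓ} (P? : Decidable P) where

    count-↭ : ∀ {xs ys} → xs ↭ ys → count P? xs ≡ count P? ys
    count-↭ xs↭ys = ↭-length (filter-↭ P? xs↭ys)

    count-++ : ∀ xs ys → count P? (xs ++ ys) ≡ count P? xs ℕ.+ count P? ys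
    count-++ xs ys = trans (cong length (ListP.filter-++ P? xs ys)) (ListP.length-++ (filter P? xs))

    count≤length : ∀ xs → count P? xs ℕ.≤ length xs
    count≤length = ListP.length-filter P?

    count-all : ∀ {xs} → All P xs → count P? xs ≡ length xs
    count-all ps = cong length (ListP.filter-all P? ps)

    count-none : ∀ {xs} → All (∁ P) xs → count P? xs ≡ 0
    count-none ps = cong length (ListP.filter-none P? ps)

  module _ (f : A → ℤ) where

    Climbs : List A → Set
    Climbs = Linked (λ a b → f b ≡ f a ℤ.+ 1ℤ)

    climb-< : ∀ {a b} → f b ≡ f a ℤ.+ 1ℤ → f a ℤ.< f b
    climb-< {a} fb = subst (f a ℤ.<_) (sym fb) (ℤP.suc[i]≤j⇒i<j (ℤP.≤-reflexive (ℤP.+-comm 1ℤ (f a))))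

    climbs-head< : ∀ {x xs y} → Climbs (x ∷ xs) → y ∈ xs → f x ℤ.< f y
    climbs-head< (fy ∷ _) (here refl) = climb-< fy
    climbs-head< (fy ∷ l) (there m)   = ℤP.<-trans (climb-< fy) (climbs-head< l m)

    climbs-head≤ : ∀ {x xs y} → Climbs (x ∷ xs) → y ∈ x ∷ xs → f x ℤ.≤ f y
    climbs-head≤ l (here refl) = ℤP.≤-refl
    climbs-head≤ l (there m)   = ℤP.<⇒≤ (climbs-head< l m)

    climbs-≤last : ∀ {x xs y} → Climbs (x ∷ xs) → y ∈ x ∷ xs → f y ℤ.≤ f (List⁺.last (x ∷ xs))
    climbs-≤last [-]                (here refl) = ℤP.≤-refl
    climbs-≤last {x} {z ∷ zs} (fz ∷ l) m rewrite last⁺-∷ x z zs with m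
    ... | here refl = ℤP.<⇒≤ (ℤP.<-≤-trans (climb-< fz) (climbs-≤last l (here refl)))
    ... | there m′  = climbs-≤last l m′

    climbs-last : ∀ {x xs} → Climbs (x ∷ xs) → f (List⁺.last (x ∷ xs)) ≡ f x ℤ.+ + length xs
    climbs-last {x} [-] = sym (ℤP.+-identityʳ (f x))
    climbs-last {x} {z ∷ zs} (fz ∷ l) = begin
      f (List⁺.last (x ∷ z ∷ zs))       ≡⟨ cong f (last⁺-∷ x z zs) ⟩
      f (List⁺.last (z ∷ zs))           ≡⟨ climbs-last l ⟩
      f z ℤ.+ + length zs               ≡⟨ cong (ℤ._+ + length zs) fz ⟩
      f x ℤ.+ 1ℤ ℤ.+ + length zs        ≡⟨ ℤP.+-assoc (f x) 1ℤ (+ length zs) ⟩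
      f x ℤ.+ (1ℤ ℤ.+ + length zs)      ≡⟨ cong (λ k → f x ℤ.+ k) (sym (ℤP.pos-+ 1 (length zs))) ⟩
      f x ℤ.+ + suc (length zs)         ∎
      where open ≡-Reasoning

    climbs-injective : ∀ {xs y z} → Climbs xs → y ∈ xs → z ∈ xs → f y ≡ f z → y ≡ z
    climbs-injective l  (here refl) (here refl) _  = refl
    climbs-injective l  (here refl) (there m)   fy = ⊥-elim (ℤP.<-irrefl fy (climbs-head< l m))
    climbs-injective l  (there m)   (here refl) fy = ⊥-elim (ℤP.<-irrefl (sym fy) (climbs-head< l m))
    climbs-injective l  (there m)   (there m′)  fy = climbs-injective (Linked.tail l) m m′ fy

below? : (x : ℤ) → Decidable (ℤ._< x)
below? x y = y ℤP.<? x

nth∈ : ∀ xs {k} → k ℕ.< length xs → nth xs k ∈ xs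
nth∈ (y ∷ ys) {zero}  _          = here refl
nth∈ (y ∷ ys) {suc k} (s≤s k<n) = there (nth∈ ys k<n)

sorted-head≤ : ∀ {y ys} → Sorted (y ∷ ys) → All (y ℤ.≤_) (y ∷ ys)
sorted-head≤ = LinkedP.Linked⇒All ℤP.≤-trans ℤP.≤-refl

module _ {x : ℤ} where

  -- In a sorted list the entries below x form an initial segment of length count (below? x).
  nth<⇒<count : ∀ {xs k} → Sorted xs → k ℕ.< length xs → nth xs k ℤ.< x → k ℕ.< count (below? x) xs
  nth<⇒<count {y ∷ ys} {k} sorted k<n nth<x with y ℤP.<? x
  nth<⇒<count {y ∷ ys} {zero}  sorted k<n       nth<x | yes _ = s≤s z≤n
  nth<⇒<count {y ∷ ys} {suc k} sorted (s≤s k<n) nth<x | yes _ = s≤s (nth<⇒<count (Linked.tail sorted) k<n nth<x)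
  nth<⇒<count {y ∷ ys} {k}     sorted k<n       nth<x | no y≮x =
    ⊥-elim (y≮x (ℤP.≤-<-trans (All.lookup (sorted-head≤ sorted) (nth∈ (y ∷ ys) k<n)) nth<x))

  <count⇒nth< : ∀ {xs k} → Sorted xs → k ℕ.< count (below? x) xs → nth xs k ℤ.< x
  <count⇒nth< {y ∷ ys} {k} sorted k<count with y ℤP.<? x
  <count⇒nth< {y ∷ ys} {zero}  sorted _               | yes y<x = y<x
  <count⇒nth< {y ∷ ys} {suc k} sorted (s≤s k<count) | yes _   = <count⇒nth< (Linked.tail sorted) k<count
  <count⇒nth< {y ∷ ys} {k}     sorted k<count       | no y≮x =
    ⊥-elim (ℕP.n≮0 (subst (k ℕ.<_) (count-none (below? x) ys≮x) k<count))
    where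
    ys≮x : All (∁ (ℤ._< x)) ys
    ys≮x = All.map (λ y≤z z<x → y≮x (ℤP.≤-<-trans y≤z z<x)) (All.tail (sorted-head≤ sorted))

  <nth⇒count≤ : ∀ {xs k} → Sorted xs → x ℤ.< nth xs k → count (below? x) xs ℕ.≤ k
  <nth⇒count≤ sorted x<nth = ℕP.≮⇒≥ (λ k<count → ℤP.<-asym x<nth (<count⇒nth< sorted k<count))

  count≤⇒<nth : ∀ {xs k} → Sorted xs → k ℕ.< length xs → x ∉ xs → count (below? x) xs ℕ.≤ k → x ℤ.< nth xs k
  count≤⇒<nth {xs} {k} sorted k<n x∉xs count≤k with ℤP.<-cmp x (nth xs k)
  ... | tri< x<nth _ _ = x<nth
  ... | tri≈ _ x≡nth _ = ⊥-elim (x∉xs (subst (_∈ xs) (sym x≡nth) (nth∈ xs k<n)))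
  ... | tri> _ _ nth<x = ⊥-elim (ℕP.<⇒≱ (nth<⇒<count sorted k<n nth<x) count≤k)

-- The conditions defining 𝓐 and 𝓑 on O = (o₁ < … < o_{r+1}) and I = (i₁ < … < i_r),
-- indexed from 0 by nth: 𝓐 sh u is u ∈λ sh × 𝓐Range (outerContents sh) (innerContents sh) (c u).
𝓐Range 𝓑Range : List ℤ → List ℤ → ℤ → Set
𝓐Range O I x = x ℤ.< nth O 0 ⊎ Σ ℕ (λ k → k ℕ.< length I × nth I k ℤ.< x × x ℤ.< nth O (suc k))
𝓑Range O I x = Σ ℕ (λ k → k ℕ.< length I × nth O k ℤ.< x × x ℤ.< nth I k) ⊎ nth O (length I) ℤ.< x

module _ {O I : List ℤ} (sortedO : Sorted O) (sortedI : Sorted I) (I<O : length I ℕ.< length O) where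

  𝓐Range⊎𝓑Range : ∀ {x} → x ∉ O → x ∉ I → 𝓐Range O I x ⊎ 𝓑Range O I x
  𝓐Range⊎𝓑Range {x} x∉O x∉I with ℕP.≤-<-connex (count (below? x) O) (count (below? x) I)
  ... | inj₁ cO≤cI with count (below? x) I in cI≡ | count≤length (below? x) I
  ...   | zero  | _      = inj₁ (inj₁ (count≤⇒<nth sortedO (ℕP.<-≤-trans (s≤s z≤n) I<O) x∉O cO≤cI))
  ...   | suc k | cI≤|I| = inj₁ (inj₂ (k , cI≤|I| , <count⇒nth< sortedI (subst (k ℕ.<_) (sym cI≡) ℕP.≤-refl)
                                   , count≤⇒<nth sortedO (ℕP.<-≤-trans (s≤s cI≤|I|) I<O) x∉O cO≤cI))
  𝓐Range⊎𝓑Range {x} x∉O x∉I | inj₂ cI<cO with ℕP.m≤n⇒m<n∨m≡n (count≤length (below? x) I)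
  ... | inj₁ cI<|I| = inj₂ (inj₁ (_ , cI<|I| , <count⇒nth< sortedO cI<cO , count≤⇒<nth sortedI cI<|I| x∉I ℕP.≤-refl))
  ... | inj₂ cI≡|I| = inj₂ (inj₂ (<count⇒nth< sortedO (subst (ℕ._< count (below? x) O) cI≡|I| cI<cO)))

  count≤⇒¬𝓑Range : ∀ {x} → count (below? x) O ℕ.≤ count (below? x) I → ¬ 𝓑Range O I x
  count≤⇒¬𝓑Range cO≤cI (inj₁ (k , k<|I| , Oₖ<x , x<Iₖ)) =
    ℕP.<⇒≱ (nth<⇒<count sortedO (ℕP.<-trans k<|I| I<O) Oₖ<x) (ℕP.≤-trans cO≤cI (<nth⇒count≤ sortedI x<Iₖ))
  count≤⇒¬𝓑Range {x} cO≤cI (inj₂ Oᵣ<x) =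
    ℕP.<⇒≱ (nth<⇒<count sortedO I<O Oᵣ<x) (ℕP.≤-trans cO≤cI (count≤length (below? x) I))

c≡⊖ : ∀ k i j → c (i , j) ≡ (k ℕ.+ j) ℤ.⊖ (k ℕ.+ i)
c≡⊖ k i j = trans (ℤP.m-n≡m⊖n j i) (sym (ℤP.+-cancelˡ-⊖ k j i))

c-< : ∀ i j k l → j ℕ.+ k ℕ.< l ℕ.+ i → c (i , j) ℤ.< c (k , l)
c-< i j k l lt = subst₂ ℤ._<_ (sym (c≡⊖ k i j)) (sym (trans (c≡⊖ i k l) (cong ((i ℕ.+ l) ℤ.⊖_) (ℕP.+-comm i k))))
  (ℤP.⊖-monoˡ-< (k ℕ.+ i) (subst₂ ℕ._<_ (ℕP.+-comm j k) (ℕP.+-comm l i) lt))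

c-≤ : ∀ i j k l → j ℕ.+ k ℕ.≤ l ℕ.+ i → c (i , j) ℤ.≤ c (k , l)
c-≤ i j k l le = subst₂ ℤ._≤_ (sym (c≡⊖ k i j)) (sym (trans (c≡⊖ i k l) (cong ((i ℕ.+ l) ℤ.⊖_) (ℕP.+-comm i k))))
  (ℤP.⊖-monoˡ-≤ (k ℕ.+ i) (subst₂ ℕ._≤_ (ℕP.+-comm j k) (ℕP.+-comm l i) le))

c-injective : ∀ i j k l → c (i , j) ≡ c (k , l) → j ℕ.+ k ≡ l ℕ.+ i
c-injective i j k l eq with ℕP.<-cmp (j ℕ.+ k) (l ℕ.+ i)
... | tri< lt _ _ = ⊥-elim (ℤP.<-irrefl eq (c-< i j k l lt))
... | tri≈ _ e≡ _ = e≡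
... | tri> _ _ gt = ⊥-elim (ℤP.<-irrefl (sym eq) (c-< k l i j gt))

c-east : ∀ u → c (e u) ≡ c u ℤ.+ 1ℤ
c-east (i , j) = trans (cong (ℤ._- + i) (ℤP.pos-+ 1 j)) (shift (+ j) (+ i))
  where
  shift : ∀ a b → 1ℤ ℤ.+ a ℤ.- b ≡ a ℤ.- b ℤ.+ 1ℤ
  shift = solve-∀

c-north : ∀ i j → c (n (suc i , j)) ≡ c (suc i , j) ℤ.+ 1ℤ
c-north i j = trans (shift (+ j) (+ i)) (cong (λ m → + j ℤ.- m ℤ.+ 1ℤ) (sym (ℤP.pos-+ 1 i)))
  where
  shift : ∀ a b → a ℤ.- b ≡ a ℤ.- (1ℤ ℤ.+ b) ℤ.+ 1ℤ
  shift = solve-∀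

nthℕ-anti : ∀ {xs i k} → Linked ℕ._≥_ xs → i ℕ.≤ k → nthℕ xs k ℕ.≤ nthℕ xs i
nthℕ-anti {[]}        _         _         = z≤n
nthℕ-anti {_ ∷ _}     {zero}  {zero}  _ _ = ℕP.≤-refl
nthℕ-anti {_ ∷ []}    {zero}  {suc k} _ _ = z≤n
nthℕ-anti {_ ∷ _ ∷ _} {zero}  {suc k} (x≥y ∷ l) _ = ℕP.≤-trans (nthℕ-anti {k = k} l z≤n) x≥y
nthℕ-anti {_ ∷ _}     {suc i} {suc k} l (s≤s i≤k) = nthℕ-anti (Linked.tail l) i≤k

rowLen-anti : ∀ sh {i k} → 1 ℕ.≤ i → i ℕ.≤ k → rowLen sh k ℕ.≤ rowLen sh i
rowLen-anti sh {suc i} {suc k} _ (s≤s i≤k) = nthℕ-anti (decreasing sh) i≤k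

NEStep-climbs : ∀ {sh a b} → a ∈λ sh → NEStep a b → c b ≡ c a ℤ.+ 1ℤ
NEStep-climbs {a = suc i , j} _ (inj₁ refl) = c-north i j
NEStep-climbs {a = a}         _ (inj₂ refl) = c-east a

NEPath-climbs : ∀ {sh p} → NEPath sh p → Climbs c (toList p)
NEPath-climbs (inλ , steps) = Linked.map (λ ((aλ , _) , ab) → NEStep-climbs aλ ab) (Linked-with-All inλ steps)

SWStep-reverses : ∀ {sh a b} → a ∈λ sh → SWStep a b → NEStep b a
SWStep-reverses                   _            (inj₁ refl) = inj₁ refl
SWStep-reverses {a = i , suc j} _            (inj₂ refl) = inj₂ refl
SWStep-reverses {a = i , zero}  (_ , () , _) (inj₂ refl)

module _ {π : Filling} {P : Path} {u : Cell} where

  -- A with-abstraction on the membership test would not fire: the goal only contains its normal form.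
  ⊖-∈ : u ∈P P → (π ⊖ P) u ≡ π u ℤ.- 1ℤ
  ⊖-∈ u∈P = by (DecMembership._∈?_ _≟ᶜ_ u (toList P))
    where
    by : (u∈?P : Dec (u ∈P P)) → (if does u∈?P then π u ℤ.- 1ℤ else π u) ≡ π u ℤ.- 1ℤ
    by (yes _)    = refl
    by (no u∉P) = ⊥-elim (u∉P u∈P)

  ⊖-∉ : ¬ u ∈P P → (π ⊖ P) u ≡ π u
  ⊖-∉ u∉P = by (DecMembership._∈?_ _≟ᶜ_ u (toList P))
    where
    by : (u∈?P : Dec (u ∈P P)) → (if does u∈?P then π u ℤ.- 1ℤ else π u) ≡ π u
    by (yes u∈P) = ⊥-elim (u∉P u∈P)
    by (no _)    = refl

val-∈λ : ∀ {sh π u} → u ∈λ sh → val π u ≡ π u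
val-∈λ {u = suc i , suc j} _ = refl

module _ {sh : Partition} {π : Filling} {P : Path} (rpp : RPP sh (π ⊖ P)) where

  private
    ≤-1⇒< : ∀ {a b} → a ℤ.≤ b ℤ.- 1ℤ → a ℤ.< b
    ≤-1⇒< {a} {b} le = ℤP.i≤pred[j]⇒i<j (subst (a ℤ.≤_) (ℤP.+-comm b (ℤ.- 1ℤ)) le)

  0<on-P : ∀ {u} → u ∈λ sh → u ∈P P → 0ℤ ℤ.< π u
  0<on-P {u} uλ u∈P = ≤-1⇒< (subst (0ℤ ℤ.≤_) (⊖-∈ {π} {P} u∈P) (proj₁ (rpp u uλ)))

  <on-P : ∀ {t u} → u ∈P P → ¬ t ∈P P → (π ⊖ P) t ℤ.≤ (π ⊖ P) u → π t ℤ.< π u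
  <on-P u∈P t∉P le = ≤-1⇒< (subst₂ ℤ._≤_ (⊖-∉ {π} {P} t∉P) (⊖-∈ {π} {P} u∈P) le)

  north<on-P : ∀ {u} → u ∈λ sh → u ∈P P → ¬ n u ∈P P → val π (n u) ℤ.< π u
  north<on-P {suc zero    , j}     uλ u∈P _ = 0<on-P uλ u∈P
  north<on-P {suc (suc i) , suc j} uλ@(_ , _ , j≤) u∈P nu∉P =
    <on-P u∈P nu∉P (proj₂ (proj₂ (rpp (suc i , suc j) nuλ)) uλ)
    where
    nuλ : (suc i , suc j) ∈λ sh
    nuλ = s≤s z≤n , s≤s z≤n , ℕP.≤-trans j≤ (rowLen-anti sh (s≤s z≤n) (ℕP.n≤1+n (suc i)))

  west<on-P : ∀ {u} → u ∈λ sh → u ∈P P → ¬ w u ∈P P → val π (w u) ℤ.< π u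
  west<on-P {suc i , suc zero}    uλ u∈P _ = 0<on-P uλ u∈P
  west<on-P {suc i , suc (suc j)} uλ@(_ , _ , j≤) u∈P wu∉P =
    <on-P u∈P wu∉P (proj₁ (proj₂ (rpp (suc i , suc j) wuλ)) uλ)
    where
    wuλ : (suc i , suc j) ∈λ sh
    wuλ = s≤s z≤n , s≤s z≤n , ℕP.≤-trans (ℕP.n≤1+n (suc j)) j≤

rowCells : ℕ → ℕ → List Cell
rowCells i l = map (λ j → (i , suc j)) (upTo l)

filter-rowCells-∷ʳ : ∀ {Q : Pred Cell 0ℓ} (Q? : Decidable Q) i l →
  filter Q? (rowCells i (suc l)) ≡ filter Q? (rowCells i l) ++ filter Q? ((i , suc l) ∷ [])
filter-rowCells-∷ʳ Q? i l = begin
  filter Q? (map (λ j → (i , suc j)) (upTo (suc l)))          ≡⟨ cong (filter Q? ∘ map (λ j → (i , suc j))) (sym (ListP.upTo-∷ʳ l)) ⟩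
  filter Q? (map (λ j → (i , suc j)) (upTo l ++ l ∷ []))      ≡⟨ cong (filter Q?) (ListP.map-++ (λ j → (i , suc j)) (upTo l) (l ∷ [])) ⟩
  filter Q? (rowCells i l ++ (i , suc l) ∷ [])                ≡⟨ ListP.filter-++ Q? (rowCells i l) _ ⟩
  filter Q? (rowCells i l) ++ filter Q? ((i , suc l) ∷ [])    ∎
  where open ≡-Reasoning

filter-row-single : ∀ {Q : Pred Cell 0ℓ} (Q? : Decidable Q) {i l g} → g ℕ.< l → Q (i , suc g) →
  (∀ {j} → Q (i , j) → j ≡ suc g) → filter Q? (rowCells i l) ≡ (i , suc g) ∷ []
filter-row-single {Q} Q? {i} {suc l} {g} g<l qg unique with ℕP.m≤n⇒m<n∨m≡n g<l
... | inj₂ refl = trans (filter-rowCells-∷ʳ Q? i l) (cong₂ _++_ (ListP.filter-none Q? none-before) (ListP.filter-accept Q? qg))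
  where
  none-before : All (∁ Q) (rowCells i g)
  none-before = AllP.map⁺ (AllP.applyUpTo⁺₁ id g (λ j<g q → ℕP.<-irrefl (ℕP.suc-injective (unique q)) j<g))
... | inj₁ (s≤s g<l′) = trans (filter-rowCells-∷ʳ Q? i l) (cong₂ _++_ (filter-row-single Q? g<l′ qg unique)
  (ListP.filter-reject Q? (λ q → ℕP.<-irrefl (ℕP.suc-injective (sym (unique q))) g<l′)))

module Corners (sh : Partition) where

  private
    L : ℕ → ℕ
    L = rowLen sh

  outerCorner-column : ∀ {i j} → OuterCorner sh (i , j) → j ≡ L i
  outerCorner-column ((i≥1 , _ , j≤) , ¬eu , _) = ℕP.≤-antisym j≤ (ℕP.≮⇒≥ (λ j< → ¬eu (i≥1 , s≤s z≤n , j<)))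

  outerCorner-drop : ∀ {i j} → OuterCorner sh (i , j) → L (suc i) ℕ.< j
  outerCorner-drop ((_ , j≥1 , _) , _ , ¬su) = ℕP.≰⇒> (λ j≤ → ¬su (s≤s z≤n , j≥1 , j≤))

  outerCorner-at : ∀ {i} → 1 ℕ.≤ i → 1 ℕ.≤ L i → L (suc i) ℕ.< L i → OuterCorner sh (i , L i)
  outerCorner-at {i} i≥1 L≥1 drop =
    (i≥1 , L≥1 , ℕP.≤-refl) , (λ (_ , _ , L<L) → ℕP.n≮n (L i) L<L) , (λ (_ , _ , L≤) → ℕP.<⇒≱ drop L≤)

  innerCorner-column : ∀ {i j} → InnerCorner sh (i , j) → j ≡ L (suc i)
  innerCorner-column (_ , (_ , _ , j≤) , ¬esu) = ℕP.≤-antisym j≤ (ℕP.≮⇒≥ (λ j< → ¬esu (s≤s z≤n , s≤s z≤n , j<)))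

  innerCorner-at : ∀ {i} → 1 ℕ.≤ i → 1 ℕ.≤ L (suc i) → L (suc i) ℕ.< L i → InnerCorner sh (i , L (suc i))
  innerCorner-at {i} i≥1 L≥1 drop =
    (i≥1 , s≤s z≤n , drop) , (s≤s z≤n , L≥1 , ℕP.≤-refl) , (λ (_ , _ , L<L) → ℕP.n≮n (L (suc i)) L<L)

  record RowsFrom (i : ℕ) (ls : List ℕ) : Set where
    field rowLen-nth : ∀ k → nthℕ ls k ≡ L (i ℕ.+ k)
  open RowsFrom

  RowsFrom-head : ∀ {i ls} → RowsFrom i ls → nthℕ ls 0 ≡ L i
  RowsFrom-head {i} ρ = trans (rowLen-nth ρ 0) (cong L (ℕP.+-identityʳ i))

  RowsFrom-tail : ∀ {i l ls} → RowsFrom i (l ∷ ls) → RowsFrom (suc i) ls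
  rowLen-nth (RowsFrom-tail {i} ρ) k = trans (rowLen-nth ρ (suc k)) (cong L (ℕP.+-suc i k))

  outer? : Decidable (OuterCorner sh)
  outer? = outerCorner? sh

  inner? : Decidable (InnerCorner sh)
  inner? = innerCorner? sh

  module Tally {D : Pred ℤ 0ℓ} (D? : Decidable D) where

    rowTally : {Q : Pred Cell 0ℓ} → Decidable Q → ℕ → ℕ → ℕ
    rowTally Q? i l = count D? (map c (filter Q? (rowCells i l)))

    tally : {Q : Pred Cell 0ℓ} → Decidable Q → ℕ → List ℕ → ℕ
    tally Q? i ls = count D? (map c (filter Q? (cellsFrom i ls)))

    tally-∷ : ∀ {Q : Pred Cell 0ℓ} (Q? : Decidable Q) i l ls →
      tally Q? i (l ∷ ls) ≡ rowTally Q? i l ℕ.+ tally Q? (suc i) ls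
    tally-∷ Q? i l ls = begin
      count D? (map c (filter Q? (rowCells i l ++ cellsFrom (suc i) ls)))
        ≡⟨ cong (count D? ∘ map c) (ListP.filter-++ Q? (rowCells i l) (cellsFrom (suc i) ls)) ⟩
      count D? (map c (filter Q? (rowCells i l) ++ filter Q? (cellsFrom (suc i) ls)))
        ≡⟨ cong (count D?) (ListP.map-++ c (filter Q? (rowCells i l)) _) ⟩
      count D? (map c (filter Q? (rowCells i l)) ++ map c (filter Q? (cellsFrom (suc i) ls)))
        ≡⟨ count-++ D? (map c (filter Q? (rowCells i l))) _ ⟩
      rowTally Q? i l ℕ.+ tally Q? (suc i) ls ∎
      where open ≡-Reasoning

    rowTally-single : ∀ {Q : Pred Cell 0ℓ} (Q? : Decidable Q) i l {g} → g ℕ.< l → Q (i , suc g) →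
      (∀ {j} → Q (i , j) → j ≡ suc g) → D (c (i , suc g)) → rowTally Q? i l ≡ 1
    rowTally-single Q? i l g<l q unique d =
      trans (cong (count D? ∘ map c) (filter-row-single Q? g<l q unique)) (count-all D? (d ∷ []))

    rowTally-none : ∀ {Q : Pred Cell 0ℓ} (Q? : Decidable Q) i l →
      (∀ {j} → Q (i , j) → ¬ D (c (i , j))) → rowTally Q? i l ≡ 0
    rowTally-none {Q} Q? i l none =
      count-none D? (AllP.map⁺ (All.zipWith (λ (¬d , q) → ¬d q) (AllP.filter⁺ Q? inRow , AllP.all-filter Q? (rowCells i l))))
      where
      inRow : All (λ u → Q u → ¬ D (c u)) (rowCells i l)
      inRow = AllP.map⁺ (AllP.applyUpTo⁺₂ id l (λ _ → none))

    outerRow-hit : ∀ i {g} → 1 ℕ.≤ i → suc g ≡ L i → L (suc i) ℕ.< L i → D (c (i , suc g)) →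
      rowTally outer? i (suc g) ≡ 1
    outerRow-hit i {g} i≥1 g≡ drop = rowTally-single outer? i (suc g) ℕP.≤-refl
      (subst (λ m → OuterCorner sh (i , m)) (sym g≡) (outerCorner-at i≥1 (subst (1 ℕ.≤_) g≡ (s≤s z≤n)) drop))
      (λ oc → trans (outerCorner-column oc) (sym g≡))

    outerRow-none : ∀ i l → L i ℕ.≤ L (suc i) → rowTally outer? i l ≡ 0
    outerRow-none i l L≤ = rowTally-none outer? i l λ oc →
      ⊥-elim (ℕP.<⇒≱ (outerCorner-drop oc) (subst (ℕ._≤ _) (sym (outerCorner-column oc)) L≤))

    innerRow-hit : ∀ i {l g} → 1 ℕ.≤ i → L (suc i) ≡ suc g → L (suc i) ℕ.< L i → l ≡ L i → D (c (i , suc g)) →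
      rowTally inner? i l ≡ 1
    innerRow-hit i {l} {g} i≥1 next≡ drop l≡ = rowTally-single inner? i l
      (ℕP.<-trans (ℕP.n<1+n g) (subst₂ ℕ._<_ next≡ (sym l≡) drop))
      (subst (λ m → InnerCorner sh (i , m)) next≡ (innerCorner-at i≥1 (subst (1 ℕ.≤_) (sym next≡) (s≤s z≤n)) drop))
      (λ ic → trans (innerCorner-column ic) next≡)

    innerRow-none : ∀ i l → L (suc i) ≡ 0 ⊎ L i ℕ.≤ L (suc i) → rowTally inner? i l ≡ 0
    innerRow-none i l no-drop = rowTally-none inner? i l λ ic → ⊥-elim (no-inner no-drop ic)
      where
      no-inner : ∀ {i j} → L (suc i) ≡ 0 ⊎ L i ℕ.≤ L (suc i) → ¬ InnerCorner sh (i , j)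
      no-inner (inj₁ L≡0) ic@(_ , (_ , j≥1 , _) , _) =
        ℕP.<-irrefl (sym (trans (innerCorner-column ic) L≡0)) j≥1
      no-inner (inj₂ L≤) ic@((_ , _ , j<L) , _ , _) =
        ℕP.<⇒≱ j<L (subst (_ ℕ.≤_) (sym (innerCorner-column ic)) L≤)

    -- A row other than the last has an outer corner iff it has an inner corner (iff the next
    -- row is shorter); the last row has an outer corner only.
    row-balanced : ∀ i {g g′} → 1 ℕ.≤ i → suc g ≡ L i → suc g′ ≡ L (suc i) →
      (∀ {j} → (i , j) ∈λ sh → D (c (i , j))) → rowTally outer? i (suc g) ≡ rowTally inner? i (suc g)
    row-balanced i {g} i≥1 this-row next D-row with L (suc i) ℕP.<? L i
    ... | yes drop = trans (outerRow-hit i i≥1 this-row drop (D-row (i≥1 , s≤s z≤n , ℕP.≤-reflexive this-row)))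
      (sym (innerRow-hit i i≥1 (sym next) drop this-row (D-row (i≥1 , s≤s z≤n , ℕP.<⇒≤ (subst (ℕ._< L i) (sym next) drop)))))
    ... | no ¬drop = trans (outerRow-none i (suc g) (ℕP.≮⇒≥ ¬drop)) (sym (innerRow-none i (suc g) (inj₂ (ℕP.≮⇒≥ ¬drop))))

    outer≡1+inner : ∀ {i l ls} → 1 ℕ.≤ i → RowsFrom i (l ∷ ls) → All (0 ℕ.<_) (l ∷ ls) →
      (∀ {k j} → i ℕ.≤ k → (k , j) ∈λ sh → D (c (k , j))) →
      tally outer? i (l ∷ ls) ≡ suc (tally inner? i (l ∷ ls))
    outer≡1+inner {i} {suc g} {[]} i≥1 ρ _ D-from = begin
      tally outer? i (suc g ∷ [])            ≡⟨ tally-∷ outer? i (suc g) [] ⟩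
      rowTally outer? i (suc g) ℕ.+ 0        ≡⟨ cong (ℕ._+ 0) (outerRow-hit i i≥1 this-row drop D-at-end) ⟩
      suc (0 ℕ.+ 0)                          ≡⟨ cong (λ m → suc (m ℕ.+ 0)) (sym (innerRow-none i (suc g) (inj₁ (sym last)))) ⟩
      suc (rowTally inner? i (suc g) ℕ.+ 0)  ≡⟨ cong suc (sym (tally-∷ inner? i (suc g) [])) ⟩
      suc (tally inner? i (suc g ∷ []))      ∎
      where
      open ≡-Reasoning
      this-row : suc g ≡ L i
      this-row = RowsFrom-head ρ
      last : 0 ≡ L (suc i)
      last = RowsFrom-head (RowsFrom-tail ρ)
      drop : L (suc i) ℕ.< L i
      drop = subst₂ ℕ._<_ last this-row (s≤s z≤n)
      D-at-end : D (c (i , suc g))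
      D-at-end = D-from ℕP.≤-refl (i≥1 , s≤s z≤n , ℕP.≤-reflexive this-row)
    outer≡1+inner {ls = zero ∷ _} _ _ (_ ∷ () ∷ _) _
    outer≡1+inner {i} {suc g} {suc g′ ∷ ls} i≥1 ρ (_ ∷ ls>0) D-from = begin
      tally outer? i (suc g ∷ suc g′ ∷ ls)
        ≡⟨ tally-∷ outer? i (suc g) (suc g′ ∷ ls) ⟩
      rowTally outer? i (suc g) ℕ.+ tally outer? (suc i) (suc g′ ∷ ls)
        ≡⟨ cong₂ ℕ._+_ (row-balanced i i≥1 (RowsFrom-head ρ) (RowsFrom-head (RowsFrom-tail ρ)) (D-from ℕP.≤-refl))
                       (outer≡1+inner (s≤s z≤n) (RowsFrom-tail ρ) ls>0 (D-from ∘ ℕP.<⇒≤)) ⟩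
      rowTally inner? i (suc g) ℕ.+ suc (tally inner? (suc i) (suc g′ ∷ ls))
        ≡⟨ ℕP.+-suc (rowTally inner? i (suc g)) _ ⟩
      suc (rowTally inner? i (suc g) ℕ.+ tally inner? (suc i) (suc g′ ∷ ls))
        ≡⟨ cong suc (sym (tally-∷ inner? i (suc g) (suc g′ ∷ ls))) ⟩
      suc (tally inner? i (suc g ∷ suc g′ ∷ ls)) ∎
      where open ≡-Reasoning

  rowsFrom-1 : RowsFrom 1 (rows sh)
  rowsFrom-1 = record { rowLen-nth = λ _ → refl }

  count-outerContents : ∀ {D : Pred ℤ 0ℓ} (D? : Decidable D) →
    count D? (outerContents sh) ≡ Tally.tally D? outer? 1 (rows sh)
  count-outerContents D? = count-↭ D? (sort-↭ _)

  count-innerContents : ∀ {D : Pred ℤ 0ℓ} (D? : Decidable D) →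
    count D? (innerContents sh) ≡ Tally.tally D? inner? 1 (rows sh)
  count-innerContents D? = count-↭ D? (sort-↭ _)

  sortedO : Sorted (outerContents sh)
  sortedO = sort-↗ _

  sortedI : Sorted (innerContents sh)
  sortedI = sort-↗ _

  inner<outer : ∀ {u} → u ∈λ sh → length (innerContents sh) ℕ.< length (outerContents sh)
  inner<outer uλ = subst₂ ℕ._<_ (sym (length≡tally (innerContents sh) (count-innerContents all?)))
                                   (sym (length≡tally (outerContents sh) (count-outerContents all?)))
    (ℕP.≤-reflexive (sym (balance (rows sh) rowsFrom-1 (positive sh) (nonempty uλ))))
    where
    all? : Decidable {A = ℤ} (λ _ → ⊤)
    all? _ = yes tt
    open Tally all?
    length≡tally : ∀ xs {t} → count all? xs ≡ t → length xs ≡ t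
    length≡tally xs = trans (sym (count-all all? (All.universal (λ _ → tt) xs)))
    balance : ∀ ls → RowsFrom 1 ls → All (0 ℕ.<_) ls → ls ≢ [] → tally outer? 1 ls ≡ suc (tally inner? 1 ls)
    balance []      _    _   ls≢[] = ⊥-elim (ls≢[] refl)
    balance (_ ∷ _) ρ ls>0 _    = outer≡1+inner (s≤s z≤n) ρ ls>0 (λ _ _ → tt)
    nonempty : ∀ {u} → u ∈λ sh → rows sh ≢ []
    nonempty {suc i , j} (_ , j≥1 , j≤) ρ≡[] = ℕP.n≮0 (ℕP.<-≤-trans j≥1 (subst (λ xs → j ℕ.≤ nthℕ xs i) ρ≡[] j≤))

  classify : ∀ {u} → u ∈λ sh → 𝓞 sh u ⊎ 𝓘 sh u ⊎ 𝓐 sh u ⊎ 𝓑 sh u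
  classify {u} uλ with DecMembership._∈?_ ℤP._≟_ (c u) (outerContents sh)
  ... | yes ∈O = inj₁ (uλ , ∈O)
  ... | no ∉O with DecMembership._∈?_ ℤP._≟_ (c u) (innerContents sh)
  ...   | yes ∈I = inj₂ (inj₁ (uλ , ∈I))
  ...   | no ∉I = inj₂ (inj₂ (Sum.map (uλ ,_) (uλ ,_) (𝓐Range⊎𝓑Range sortedO sortedI (inner<outer uλ) ∉O ∉I)))

  -- For α = (ia , ja) with s α ∉ λ: no outer corner in rows ≤ ia has content below c α,
  -- every cell of a later row has, and row ia has an inner corner below c α exactly when
  -- row ia + 1 is nonempty.
  module BottomCell {ia ja : ℕ} (αλ : (ia , ja) ∈λ sh) (¬sα : ¬ s (ia , ja) ∈λ sh) where

    open Tally (below? (c (ia , ja)))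

    next<ja : L (suc ia) ℕ.< ja
    next<ja = ℕP.≰⇒> (λ ja≤ → ¬sα (s≤s z≤n , proj₁ (proj₂ αλ) , ja≤))

    below-later-rows : ∀ {k j} → suc ia ℕ.≤ k → (k , j) ∈λ sh → c (k , j) ℤ.< c (ia , ja)
    below-later-rows {k} {j} ia<k (_ , _ , j≤) =
      c-< k j ia ja (ℕP.+-mono-<-≤ (ℕP.≤-<-trans (ℕP.≤-trans j≤ (rowLen-anti sh (s≤s z≤n) ia<k)) next<ja) (ℕP.<⇒≤ ia<k))

    outerRow-not-below : ∀ i l → i ℕ.≤ ia → rowTally outer? i l ≡ 0
    outerRow-not-below i l i≤ia = rowTally-none outer? i l λ {j} oc →
      ℤP.≤⇒≯ (c-≤ ia ja i j (ℕP.+-mono-≤ (ℕP.≤-trans (proj₂ (proj₂ αλ))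
                                  (subst (L ia ℕ.≤_) (sym (outerCorner-column oc)) (rowLen-anti sh (proj₁ (proj₁ oc)) i≤ia)))
                                i≤ia))

    outer≤inner-after : ∀ {l ls} → RowsFrom ia (l ∷ ls) → All (0 ℕ.<_) ls →
      tally outer? (suc ia) ls ℕ.≤ rowTally inner? ia l ℕ.+ tally inner? (suc ia) ls
    outer≤inner-after {ls = []} _ _ = z≤n
    outer≤inner-after {ls = zero ∷ _} _ (() ∷ _)
    outer≤inner-after {l} {suc g′ ∷ ls} ρ ls>0 = ℕP.≤-reflexive (begin
      tally outer? (suc ia) (suc g′ ∷ ls)       ≡⟨ outer≡1+inner (s≤s z≤n) (RowsFrom-tail ρ) ls>0 below-later-rows ⟩
      suc (tally inner? (suc ia) (suc g′ ∷ ls)) ≡⟨ cong (ℕ._+ _) (sym (innerRow-hit ia (proj₁ αλ) (sym next) drop (RowsFrom-head ρ) inner-below)) ⟩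
      rowTally inner? ia l ℕ.+ tally inner? (suc ia) (suc g′ ∷ ls) ∎)
      where
      open ≡-Reasoning
      next : suc g′ ≡ L (suc ia)
      next = RowsFrom-head (RowsFrom-tail ρ)
      drop : L (suc ia) ℕ.< L ia
      drop = ℕP.<-≤-trans next<ja (proj₂ (proj₂ αλ))
      inner-below : c (ia , suc g′) ℤ.< c (ia , ja)
      inner-below = c-< ia (suc g′) ia ja (ℕP.+-monoˡ-< ia (subst (ℕ._< ja) (sym next) next<ja))

    outer≤inner : ∀ {i ls} → i ℕ.≤ ia → RowsFrom i ls → All (0 ℕ.<_) ls →
      tally outer? i ls ℕ.≤ tally inner? i ls
    outer≤inner {ls = []} _ _ _ = z≤n
    outer≤inner {i} {l ∷ ls} i≤ia ρ (_ ∷ ls>0) = begin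
      tally outer? i (l ∷ ls)                             ≡⟨ tally-∷ outer? i l ls ⟩
      rowTally outer? i l ℕ.+ tally outer? (suc i) ls     ≡⟨ cong (ℕ._+ _) (outerRow-not-below i l i≤ia) ⟩
      tally outer? (suc i) ls                             ≤⟨ later (ℕP.m≤n⇒m<n∨m≡n i≤ia) ⟩
      rowTally inner? i l ℕ.+ tally inner? (suc i) ls     ≡⟨ tally-∷ inner? i l ls ⟨
      tally inner? i (l ∷ ls)                             ∎
      where
      open ℕP.≤-Reasoning
      later : i ℕ.< ia ⊎ i ≡ ia → tally outer? (suc i) ls ℕ.≤ rowTally inner? i l ℕ.+ tally inner? (suc i) ls
      later (inj₁ i<ia) = ℕP.≤-trans (outer≤inner i<ia (RowsFrom-tail ρ) ls>0) (ℕP.m≤n+m _ _)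
      later (inj₂ refl) = outer≤inner-after ρ ls>0

    bottom∉𝓑Range : ¬ 𝓑Range (outerContents sh) (innerContents sh) (c (ia , ja))
    bottom∉𝓑Range = count≤⇒¬𝓑Range sortedO sortedI (inner<outer αλ)
      (subst₂ ℕ._≤_ (sym (count-outerContents _)) (sym (count-innerContents _))
        (outer≤inner (proj₁ αλ) rowsFrom-1 (positive sh)))

    innerCorner-content≢ : ∀ {k j} → InnerCorner sh (k , j) → ja ℕ.+ k ≢ j ℕ.+ ia
    innerCorner-content≢ {k} {j} ic with ℕP.<-≤-connex k ia
    ... | inj₁ k<ia = λ eq → ℕP.<-irrefl eq (ℕP.+-mono-≤-< ja≤j k<ia)
      where
      ja≤j : ja ℕ.≤ j
      ja≤j = ℕP.≤-trans (proj₂ (proj₂ αλ)) (subst (L ia ℕ.≤_) (sym (innerCorner-column ic)) (rowLen-anti sh (s≤s z≤n) k<ia))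
    ... | inj₂ ia≤k = λ eq → ℕP.<-irrefl (sym eq) (ℕP.+-mono-<-≤ j<ja ia≤k)
      where
      j<ja : j ℕ.< ja
      j<ja = ℕP.≤-<-trans (subst (ℕ._≤ L (suc ia)) (sym (innerCorner-column ic)) (rowLen-anti sh (s≤s z≤n) (s≤s ia≤k))) next<ja

    bottom∉𝓘 : c (ia , ja) ∉ innerContents sh
    bottom∉𝓘 cα∈I with ∈-map⁻ c (∈-resp-↭ (sort-↭ _) cα∈I)
    ... | (k , j) , ∈filter , cα≡ = innerCorner-content≢ (proj₂ (∈-filter⁻ inner? {xs = cells sh} ∈filter)) (c-injective ia ja k j cα≡)

module SouthWestPath {sh : Partition} {π : Filling} {P : Path}
  (swP : SWPath sh P) (cmp : Compatible sh P π) (rpp : RPP sh (π ⊖ P)) where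

  open Corners sh using (classify; module BottomCell)

  q : Path
  q = reverse⁺ P

  ∈P⇒∈q : ∀ {u} → u ∈P P → u ∈ toList q
  ∈P⇒∈q u∈P = subst (_ ∈_) (sym (toList-reverse⁺ P)) (AnyP.reverse⁺ u∈P)

  ∈q⇒∈P : ∀ {u} → u ∈ toList q → u ∈P P
  ∈q⇒∈P u∈q = AnyP.reverse⁻ (subst (_ ∈_) (toList-reverse⁺ P) u∈q)

  InP : Cell → Set
  InP u = u ∈λ sh × u ∈P P

  steps : Linked (λ a b → (InP a × InP b) × SWStep a b) (toList P)
  steps = Linked-with-All (All.zip (proj₁ swP , All.tabulate id)) (proj₂ swP)

  q-NEPath : NEPath sh q
  q-NEPath = subst (All (_∈λ sh)) (sym (toList-reverse⁺ P)) (reverse-All (proj₁ swP))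
           , subst (Linked NEStep) (sym (toList-reverse⁺ P))
               (reverse-Linked (Linked.map (λ (((aλ , _) , _) , ab) → SWStep-reverses aλ ab) steps))

  q-climbs : Climbs c (toList q)
  q-climbs = NEPath-climbs q-NEPath

  P-injective : ∀ {u v} → u ∈P P → v ∈P P → c u ≡ c v → u ≡ v
  P-injective u∈P v∈P = climbs-injective c q-climbs (∈P⇒∈q u∈P) (∈P⇒∈q v∈P)

  c-αSW≤ : ∀ {u} → u ∈P P → c (αSW P) ℤ.≤ c u
  c-αSW≤ u∈P = subst (λ v → c v ℤ.≤ _) (head-reverse⁺ P) (climbs-head≤ c q-climbs (∈P⇒∈q u∈P))

  c≤ωSW : ∀ {u} → u ∈P P → c u ℤ.≤ c (ωSW P)
  c≤ωSW u∈P = subst (λ v → _ ℤ.≤ c v) (last-reverse⁺ P) (climbs-≤last c q-climbs (∈P⇒∈q u∈P))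

  α∈P : αSW P ∈P P
  α∈P = subst (_∈P P) (head-reverse⁺ P) (∈q⇒∈P (here refl))

  αλ : αSW P ∈λ sh
  αλ = All.lookup (proj₁ swP) α∈P

  ωλ : ωSW P ∈λ sh
  ωλ = All.head (proj₁ swP)

  ¬north-and-east : ∀ {u} → u ∈λ sh → n u ∈P P → ¬ e u ∈P P
  ¬north-and-east {suc i , j} _ nu∈P eu∈P =
    ℕP.1+n≢n (sym (cong proj₂ (P-injective nu∈P eu∈P (trans (c-north i j) (sym (c-east (suc i , j)))))))

  north-of-ω∉P : ¬ n (ωSW P) ∈P P
  north-of-ω∉P nω∈P = ℤP.≤⇒≯ (c≤ωSW nω∈P) (climb-< c {ωSW P} {n (ωSW P)} (NEStep-climbs ωλ (inj₁ refl)))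

  west-of-α∉P : ¬ w (αSW P) ∈P P
  west-of-α∉P = west-of-minimum αλ c-αSW≤
    where
    west-of-minimum : ∀ {v} → v ∈λ sh → (∀ {u} → u ∈P P → c v ℤ.≤ c u) → ¬ w v ∈P P
    west-of-minimum {i , suc j} _ minimum wv∈P = ℤP.≤⇒≯ (minimum wv∈P) (climb-< c {i , j} {i , suc j} (c-east (i , j)))

  SWStep⇒QStep : ∀ {a b} → InP a → InP b → SWStep a b → QStep sh π b a
  SWStep⇒QStep {a} {b} (aλ , a∈P) (bλ , b∈P) (inj₁ refl) =
    inj₁ (O⊎B , sym (trans (val-∈λ aλ) (proj₂ cmp a a∈P b∈P)) , refl)
    where
    O⊎B : 𝓞 sh b ⊎ 𝓑 sh b
    O⊎B with classify bλ
    ... | inj₁ O               = inj₁ O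
    ... | inj₂ (inj₁ I)        = ⊥-elim (¬north-and-east bλ a∈P (proj₁ (proj₁ cmp b b∈P (inj₁ I))))
    ... | inj₂ (inj₂ (inj₁ A)) = ⊥-elim (¬north-and-east bλ a∈P (proj₁ (proj₁ cmp b b∈P (inj₂ A))))
    ... | inj₂ (inj₂ (inj₂ B)) = inj₂ B
  SWStep⇒QStep {i , suc j} (aλ , a∈P) (bλ , b∈P) (inj₂ refl) =
    inj₂ (inj₂ (aλ , north<on-P rpp bλ b∈P (λ nb∈P → ¬north-and-east bλ nb∈P a∈P)) , refl)

  q-QSteps : Linked (QStep sh π) (toList q)
  q-QSteps = subst (Linked (QStep sh π)) (sym (toList-reverse⁺ P))
    (reverse-Linked (Linked.map (λ ((a , b) , ab) → SWStep⇒QStep a b ab) steps))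

  q-stops : ¬ e (ωSW P) ∈λ sh → QStop sh π (List⁺.last q)
  q-stops ¬eω = subst (QStop sh π) (sym (last-reverse⁺ P)) (north<on-P rpp ωλ (here refl) north-of-ω∉P , ¬eω)

  P≡reverse-q : toList P ≡ reverse (toList q)
  P≡reverse-q = sym (trans (cong reverse (toList-reverse⁺ P)) (ListP.reverse-involutive (toList P)))

  c-αSW≡c-αNE : ∀ {h} → NEPath sh h → ωSW P ≡ ωNE h → len P ≡ len h → c (αSW P) ≡ c (αNE h)
  c-αSW≡c-αNE {h} hNE ω≡ len≡ = ∙-cancelʳ (+ len h) (c (αSW P)) (c (αNE h)) (begin
    c (αSW P) ℤ.+ + len h          ≡⟨ cong₂ (λ v m → c v ℤ.+ + m) (sym (head-reverse⁺ P)) (sym (trans len-q len≡)) ⟩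
    c (List⁺.head q) ℤ.+ + len q   ≡⟨ climbs-last c q-climbs ⟨
    c (List⁺.last q)               ≡⟨ cong c (trans (last-reverse⁺ P) ω≡) ⟩
    c (ωNE h)                      ≡⟨ climbs-last c (NEPath-climbs hNE) ⟩
    c (αNE h) ℤ.+ + len h          ∎)
    where
    open ≡-Reasoning
    len-q : len q ≡ len P
    len-q = ℕP.suc-injective (trans (cong length (toList-reverse⁺ P)) (ListP.length-reverse (toList P)))

  α-candidate : ∀ {ia ja} → (ia , ja) ∈λ sh → ¬ s (ia , ja) ∈λ sh → c (αSW P) ≡ c (ia , ja) → Cand sh π (αSW P)
  α-candidate βλ ¬sβ cα≡ with classify αλ
  ... | inj₁ O = inj₁ (O , west<on-P rpp αλ α∈P west-of-α∉P)
  ... | inj₂ (inj₁ (_ , ∈I)) = ⊥-elim (BottomCell.bottom∉𝓘 βλ ¬sβ (subst (_∈ innerContents sh) cα≡ ∈I))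
  ... | inj₂ (inj₂ (inj₁ A)) = inj₂ (A , west<on-P rpp αλ α∈P west-of-α∉P ,
    north<on-P rpp αλ α∈P (λ nα∈P → ¬north-and-east αλ nα∈P (proj₁ (proj₁ cmp _ α∈P (inj₂ A)))))
  ... | inj₂ (inj₂ (inj₂ (_ , B))) =
    ⊥-elim (BottomCell.bottom∉𝓑Range βλ ¬sβ (subst (𝓑Range (outerContents sh) (innerContents sh)) cα≡ B))

mainTheorem6 : (sh : Partition) (π : Filling) → RPP sh π →
    (h : Path) → Factor sh π h →
    (P : Path) → SWPath sh P → ωSW P ≡ ωNE h → len P ≡ len h →
    Compatible sh P π → RPP sh (π ⊖ P) →
    Cand sh π (αSW P)
    × ∃ (λ q → IsQ sh π (αSW P) q × toList P ≡ reverse (toList q))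
mainTheorem6 sh π _ _ ((hNE , ¬sα , ¬eω , _) , _) P swP ω≡ len≡ cmp rpp =
  α-candidate (All.head (proj₁ hNE)) ¬sα (c-αSW≡c-αNE hNE ω≡ len≡) ,
  q , (q-NEPath , head-reverse⁺ P , q-QSteps , q-stops (subst (λ u → ¬ e u ∈λ sh) (sym ω≡) ¬eω)) , P≡reverse-q
  where open SouthWestPath swP cmp rpp
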